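{- Every consistent $\mathbb{F}$-augmented generalized closure space is locally consistent.
   Context: A closure operator on $X$ is a map $\gamma:\mathcal{P}(X)\to\mathcal{P}(X)$ that is extensive, idempotent and monotone. A generalized closure space is a pair $(X,\tau\circ\gamma)$ where $\gamma$ is a closure operator and $\tau:\mathcal{P}(X)\to\mathcal{P}(X)$ satisfies for all $A,B\subseteq X$: $\tau(\gamma(A))\subseteq\gamma(A)$; $\tau(\tau(\gamma(A)))=\tau(\gamma(A))$; $A\subseteq B\Rightarrow\tau(\gamma(A))\subseteq\tau(\gamma(B))$. Write $\langle A\rangle=\tau(\gamma(A))$. An $\mathbb{F}$-augmented generalized closure space is a triple $(X,\tau\circ\gamma,\mathcal{F})$ with $(X,\tau\circ\gamma)$ a generalized closure space and $\mathcal{F}$ a nonempty family of finite subsets of $X$ such that for every $F\in\mathcal{F}$ and finite $M\subseteq\langle F\rangle$ there is $F_1\in\mathcal{F}$ with $M\subseteq\langle F_1\rangle$ and $F_1\subseteq\langle F\rangle$. For $F\in\mathcal{F}$ and finite $M\subseteq\langle F\rangle$, an $F$-sup of $M$ is $G\in\mathcal{F}$ such that (L1) $\langle M\rangle\subseteq\langle G\rangle$ and $G\subseteq\langle F\rangle$, and (L2) for every $G_1\in\mathcal{F}$, $\langle M\rangle\subseteq\langle G_1\rangle\subseteq\langle F\rangle$ implies $\langle G\rangle\subseteq\langle G_1\rangle$; $\Sigma(F,M)$ denotes the set of $F$-sups of $M$. The space is locally consistent if $\Sigma(F,M)\neq\emptyset$ for all $F\in\mathcal{F}$ and finite $M\subseteq\langle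 F\rangle$, and consistent if for every $F\in\mathcal{F}$, every finite $M\subseteq\langle F\rangle$ belongs to $\mathcal{F}$. -}

module Defs where

open import Level using (Level; suc; _⊔_)
open import Data.Product using (Σ; ∃; _×_; _,_)
open import Data.List using (List)
open import Data.List.Membership.Propositional using () renaming (_∈_ to _∈ₗ_)
open import Function.Bundles using (_⇔_)
open import Relation.Unary using (Pred; _∈_; _⊆_)

_≐_ : ∀ {a ℓ} {X : Set a} → Pred X ℓ → Pred X ℓ → Set (a ⊔ ℓ)
A ≐ B = (A ⊆ B) × (B ⊆ A)

Finite : ∀ {a ℓ} {X : Set a} → Pred X ℓ → Set (a ⊔ ℓ)
Finite {X = X} A = Σ (List X) λ xs → ∀ x → (x ∈ A) ⇔ (x ∈ₗ xs)

module _ {a ℓ : Level} {X : Set a} where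

  Subset : Set (a ⊔ suc ℓ)
  Subset = Pred X ℓ

  record IsClosureOperator (γ : Subset → Subset) : Set (a ⊔ suc ℓ) where
    field
      extensive  : ∀ A → A ⊆ γ A
      idempotent : ∀ A → γ (γ A) ≐ γ A
      monotone   : ∀ {A B} → A ⊆ B → γ A ⊆ γ B

  record IsGeneralizedClosureSpace (τ γ : Subset → Subset) : Set (a ⊔ suc ℓ) where
    field
      isClosure  : IsClosureOperator γ
      τ-shrink   : ∀ A → τ (γ A) ⊆ γ A
      τ-idem     : ∀ A → τ (τ (γ A)) ≐ τ (γ A)
      τγ-mono    : ∀ {A B} → A ⊆ B → τ (γ A) ⊆ τ (γ B)

  ⟨_⟩[_,_] : Subset → (Subset → Subset) → (Subset → Subset) → Subset
  ⟨ A ⟩[ τ , γ ] = τ (γ A)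

  -- 𝔽-augmented generalized closure space (X , τ ∘ γ , 𝓕).
  -- 𝓕 is a family of subsets (a predicate on subsets); since subsets are
  -- predicates, we require membership in 𝓕 to respect extensional equality
  -- (sets with the same elements are the same set).
  record IsFAugmented (τ γ : Subset → Subset) (𝓕 : Pred Subset ℓ)
         : Set (a ⊔ suc ℓ) where
    field
      isGCS      : IsGeneralizedClosureSpace τ γ
      𝓕-ext      : ∀ {A B} → A ≐ B → A ∈ 𝓕 → B ∈ 𝓕
      𝓕-nonempty : ∃ λ (F : Subset) → F ∈ 𝓕
      𝓕-finite   : ∀ F → F ∈ 𝓕 → Finite F
      augmented  : ∀ F → F ∈ 𝓕 → ∀ (M : Subset) → Finite M → M ⊆ τ (γ F) →
                   ∃ λ (F₁ : Subset) → F₁ ∈ 𝓕 × M ⊆ τ (γ F₁) × F₁ ⊆ τ (γ F)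

  module _ (τ γ : Subset → Subset) (𝓕 : Pred Subset ℓ) where

    IsFSup : Subset → Subset → Subset → Set (a ⊔ suc ℓ)
    IsFSup F M G =
      G ∈ 𝓕 ×
      (τ (γ M) ⊆ τ (γ G) × G ⊆ τ (γ F)) ×
      (∀ G₁ → G₁ ∈ 𝓕 → τ (γ M) ⊆ τ (γ G₁) → τ (γ G₁) ⊆ τ (γ F) →
         τ (γ G) ⊆ τ (γ G₁))

    LocallyConsistent : Set (a ⊔ suc ℓ)
    LocallyConsistent =
      ∀ F → F ∈ 𝓕 → ∀ (M : Subset) → Finite M → M ⊆ τ (γ F) →
        ∃ λ (G : Subset) → IsFSup F M G

    Consistent : Set (a ⊔ suc ℓ)
    Consistent =
      ∀ F → F ∈ 𝓕 → ∀ (M : Subset) → Finite M → M ⊆ τ (γ F) → M ∈ 𝓕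

module Submission where

-- In a consistent space every finite M ⊆ ⟨F⟩ (F ∈ 𝓕) already
-- belongs to 𝓕, and any such member of 𝓕 is its own F-sup:
--   (L1) ⟨M⟩ ⊆ ⟨M⟩ holds trivially and M ⊆ ⟨F⟩ is the hypothesis;
--   (L2) if ⟨M⟩ ⊆ ⟨G₁⟩ then in particular ⟨M⟩ ⊆ ⟨G₁⟩ — the required bound.

open import Defs
open import Level using (Level)
open import Relation.Unary using (Pred; _∈_; _⊆_)
open import Data.Product using (_,_)

module _ {a ℓ : Level} {X : Set a}
         (τ γ : Pred X ℓ → Pred X ℓ) (𝓕 : Pred (Pred X ℓ) ℓ) where

  self-FSup : ∀ F M → M ∈ 𝓕 → M ⊆ τ (γ F) → IsFSup τ γ 𝓕 F M M
  self-FSup F M M∈𝓕 M⊆⟨F⟩ =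
    M∈𝓕 , ((λ x∈⟨M⟩ → x∈⟨M⟩) , M⊆⟨F⟩) , λ G₁ _ ⟨M⟩⊆⟨G₁⟩ _ → ⟨M⟩⊆⟨G₁⟩

proposition3p26 : ∀ {a ℓ : Level} {X : Set a}
    (τ γ : Pred X ℓ → Pred X ℓ) (𝓕 : Pred (Pred X ℓ) ℓ) →
    IsFAugmented τ γ 𝓕 → Consistent τ γ 𝓕 → LocallyConsistent τ γ 𝓕
proposition3p26 τ γ 𝓕 _ consistent F F∈𝓕 M finM M⊆⟨F⟩ =
  M , self-FSup τ γ 𝓕 F M (consistent F F∈𝓕 M finM M⊆⟨F⟩) M⊆⟨F⟩
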